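{- Let $\Gamma$ be a strictly Deza graph with parameters $(n,k,b,a)$ such that $k=b+1$ and $\beta(\Gamma)>1$, and let $x$ be a vertex of type (A). (1) If $x$ is of type (A1), then $B[v]\subseteq N(x)\setminus\{x^{\star}\}$ for every $v\in N(x)\setminus\{x^{\star}\}$. (2) If $x$ is of type (A2), then $B[v]\subseteq N(x)\setminus B(x^{\star})$ for every $v\in N(x)\setminus B(x^{\star})$.
   Context: Graphs are finite, simple, undirected. $N(v)$ is the neighbourhood of $v$ and $N_2(v)$ the set of vertices at distance $2$ from $v$. A Deza graph with parameters $(n,k,b,a)$, $b\ge a$, is a nonempty $k$-regular graph on $n$ vertices in which every pair of distinct vertices has exactly $b$ or exactly $a$ common neighbours; it is strictly Deza if it has diameter $2$ and is not strongly regular. $B(v)=\{u: |N(u)\cap N(v)|=b\}$, $B[v]=B(v)\cup\{v\}$; $\beta(\Gamma)=|B(v)|$ (independent of $v$). A vertex $v$ is of type (A) if $B(v)\cap N(v)=\emptyset$. A vertex $x$ of type (A) is of type (A1) if there is a unique vertex $y\in N(x)$ with $\{y\}=N(x)\setminus N(x_i)$ for all $x_i\in B(x)$ and $|\bigcup_{x_i\in B(x)}(N(x_i)\setminus N(x))|=\beta(\Gamma)$; in this case $x^{\star}:=y$. It is of type (A2) if there is a unique vertex $z\in N_2(x)$ with $\{z\}=N(x_i)\setminus N(x)$ for all $x_i\in B(x)$ and $|\bigcup_{x_i\in B(x)}(N(x)\setminus N(x_i))|=\beta(\Gamma)$; in this case $x^{\star}:=z$. (Every vertex of type (A) is of type (A1)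 or (A2) in this setting.) -}

module Defs where

open import Data.Nat using (ℕ; zero; suc; _+_; _≤_; _<_; _≡ᵇ_)
open import Data.Bool using (Bool; true; false; _∧_; not; if_then_else_)
open import Data.Fin using (Fin; _≟_)
open import Data.List using (List; map)
open import Data.Nat.ListAction using (sum)
open import Data.List using () renaming (allFin to allFinL)
open import Data.Product using (Σ; ∃; ∃-syntax; _×_; _,_)
open import Data.Sum using (_⊎_)
open import Relation.Nullary using (¬_)
open import Relation.Nullary.Decidable using (⌊_⌋)
open import Relation.Binary.PropositionalEquality using (_≡_; _≢_)

record Graph (n : ℕ) : Set where
  field
    adj   : Fin n → Fin n → Bool
    sym   : ∀ u v → adj u v ≡ adj v u
    irrefl : ∀ v → adj v v ≡ false

module _ {n : ℕ} (Γ : Graph n) where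
  open Graph Γ

  count : (Fin n → Bool) → ℕ
  count p = sum (map (λ w → if p w then 1 else 0) (allFinL n))

  Adj : Fin n → Fin n → Set
  Adj u v = adj u v ≡ true

  deg : Fin n → ℕ
  deg v = count (λ w → adj v w)

  common : Fin n → Fin n → ℕ
  common u v = count (λ w → adj u w ∧ adj v w)

  Regular : ℕ → Set
  Regular k = ∀ v → deg v ≡ k

  IsDeza : ℕ → ℕ → ℕ → Set
  IsDeza k b a =
    (0 < n) × (a ≤ b) × Regular k ×
    (∀ u v → u ≢ v → (common u v ≡ b) ⊎ (common u v ≡ a))

  Diameter2 : Set
  Diameter2 =
    (∀ u v → u ≢ v → Adj u v ⊎ (1 ≤ common u v)) ×
    (∃[ u ] ∃[ v ] (u ≢ v × ¬ Adj u v))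

  StronglyRegular : Set
  StronglyRegular =
    ∃[ k ] ∃[ λ' ] ∃[ μ ]
      (Regular k ×
       (∀ u v → u ≢ v → Adj u v → common u v ≡ λ') ×
       (∀ u v → u ≢ v → ¬ Adj u v → common u v ≡ μ))

  IsStrictlyDeza : ℕ → ℕ → ℕ → Set
  IsStrictlyDeza k b a = IsDeza k b a × Diameter2 × ¬ StronglyRegular

  module WithB (b : ℕ) where
    -- Boolean membership: u ∈ B(v)  (u ≠ v and |N(u) ∩ N(v)| = b)
    inB : Fin n → Fin n → Bool
    inB v u = not ⌊ u ≟ v ⌋ ∧ (common u v ≡ᵇ b)

    InB : Fin n → Fin n → Set
    InB v u = inB v u ≡ true

    InB[] : Fin n → Fin n → Set
    InB[] v u = InB v u ⊎ u ≡ v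

    βof : Fin n → ℕ
    βof v = count (inB v)

    TypeA : Fin n → Set
    TypeA v = ∀ u → InB v u → ¬ Adj v u

    -- x is of type (A1) with x⋆ = y
    TypeA1 : Fin n → Fin n → Set
    TypeA1 x y =
      Adj x y ×
      (∀ xi → InB x xi → ∀ w → ((Adj x w × ¬ Adj xi w) → w ≡ y)
                                × (w ≡ y → (Adj x w × ¬ Adj xi w))) ×
      (count (λ w → not (adj x w) ∧
                    Data.List.foldr (λ xi r → (inB x xi ∧ adj xi w) Data.Bool.∨ r)
                                    false (allFinL n))
        ≡ βof x)

    -- x is of type (A2) with x⋆ = z
    TypeA2 : Fin n → Fin n → Set
    TypeA2 x z =
      (z ≢ x × ¬ Adj x z × 1 ≤ common x z) ×
      (∀ xi → InB x xi → ∀ w → ((Adj xi w × ¬ Adj x w) → w ≡ z)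
                                × (w ≡ z → (Adj xi w × ¬ Adj x w))) ×
      (count (λ w → adj x w ∧
                    Data.List.foldr (λ xi r → (inB x xi ∧ not (adj xi w)) Data.Bool.∨ r)
                                    false (allFinL n))
        ≡ βof x)

-- Since k = b + 1, a vertex u ∈ B(v) misses exactly one neighbour of v, so any two
-- neighbours of v outside N(u) coincide.  Every step below reduces to this: β(x) > 1 is
-- contradicted as soon as all of B(x) lies in such a one-element difference, or as soon as
-- the union in the definition of type (A1)/(A2) collapses to a single vertex.  For
-- u ∉ B(x⋆) in case (A2) one first counts common neighbours of x⋆ with u and with v to get
-- b = a + 1; then u (adjacent to x, so |N(u) ∩ N(x)| = a) has exactly two neighbours outside
-- N(x), one of which is x, while all of B(x) is among them.

module Submission where

open import Defs
open import Data.Nat using (ℕ; zero; suc; _+_; _≤_; _<_; z≤n; s≤s)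
open import Data.Nat.Properties
  using (+-comm; +-suc; +-identityʳ; +-cancelˡ-≡; suc-injective; ≤-reflexive; ≤-antisym; ≤-trans; m≤n+m; <⇒≱;
         n≤1⇒n≡0∨n≡1; ≡ᵇ⇒≡; ≡⇒≡ᵇ; module ≤-Reasoning)
open import Data.Fin using (Fin; zero; suc; _≟_)
open import Data.Fin.Properties using () renaming (suc-injective to Fin-suc-injective)
open import Data.Bool using (Bool; true; false; _∧_; _∨_; not; if_then_else_)
open import Data.Bool.Properties
  using (∧-comm; ∧-assoc; ∧-identityʳ; ∧-zeroʳ; ∧-conicalˡ; ∧-conicalʳ; not-injective; not-¬; ¬-not; T-≡)
  renaming (_≟_ to _≟ᵇ_)
open import Data.List using (List; _∷_; foldr; tabulate; allFin)
open import Data.List.Properties using (map-tabulate)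
open import Data.Nat.ListAction using (sum)
open import Data.Product using (_×_; _,_; proj₁; proj₂; ∃)
open import Data.Sum using (_⊎_; inj₁; inj₂)
open import Function using (_∘_; id)
open import Function.Bundles using (Equivalence)
open import Relation.Nullary using (¬_; Dec; yes; no; contradiction)
open import Relation.Nullary.Decidable using (⌊_⌋; decidable-stable)
open import Relation.Binary.PropositionalEquality

∧-true : ∀ {p q} → p ≡ true → q ≡ true → p ∧ q ≡ true
∧-true refl refl = refl

not≡true⇒¬ : ∀ {p} → not p ≡ true → ¬ p ≡ true
not≡true⇒¬ = not-¬ ∘ not-injective {y = false}

¬⇒not≡true : ∀ {p} → ¬ p ≡ true → not p ≡ true
¬⇒not≡true = cong not ∘ ¬-not

foldr-∨-true : ∀ {ℓ} {A : Set ℓ} (f : A → Bool) (xs : List A) →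
               foldr (λ a r → f a ∨ r) false xs ≡ true → ∃ λ a → f a ≡ true
foldr-∨-true f (a ∷ xs) h with f a in fa
... | true  = a , fa
... | false = foldr-∨-true f xs h

≡⇒⌊≟⌋-true : ∀ {n} {w u : Fin n} → w ≡ u → ⌊ w ≟ u ⌋ ≡ true
≡⇒⌊≟⌋-true {w = w} {u} w≡u with w ≟ u
... | yes _   = refl
... | no  w≢u = contradiction w≡u w≢u

≢⇒⌊≟⌋-false : ∀ {n} {w u : Fin n} → w ≢ u → ⌊ w ≟ u ⌋ ≡ false
≢⇒⌊≟⌋-false {w = w} {u} w≢u with w ≟ u
... | yes w≡u = contradiction w≡u w≢u
... | no  _   = refl

⌊≟⌋-true⇒≡ : ∀ {n} {w u : Fin n} → ⌊ w ≟ u ⌋ ≡ true → w ≡ u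
⌊≟⌋-true⇒≡ {w = w} {u} h with w ≟ u
... | yes w≡u = w≡u

size : ∀ {n} → (Fin n → Bool) → ℕ
size {zero}  P = 0
size {suc n} P = (if P zero then 1 else 0) + size (P ∘ suc)

count≡size : ∀ {n} (Γ : Graph n) (P : Fin n → Bool) → count Γ P ≡ size P
count≡size Γ P = trans (cong sum (map-tabulate id (λ w → if P w then 1 else 0))) (sum-tabulate P)
  where
  sum-tabulate : ∀ {n} (P : Fin n → Bool) →
                 sum (tabulate (λ w → if P w then 1 else 0)) ≡ size P
  sum-tabulate {zero}  P = refl
  sum-tabulate {suc n} P = cong ((if P zero then 1 else 0) +_) (sum-tabulate (P ∘ suc))

size-cong : ∀ {n} {P Q : Fin n → Bool} → (∀ w → P w ≡ Q w) → size P ≡ size Q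
size-cong {zero}  P≗Q = refl
size-cong {suc n} P≗Q =
  cong₂ _+_ (cong (λ c → if c then 1 else 0) (P≗Q zero)) (size-cong (P≗Q ∘ suc))

size-split : ∀ {n} (P Q : Fin n → Bool) →
             size P ≡ size (λ w → P w ∧ Q w) + size (λ w → P w ∧ not (Q w))
size-split {zero}  P Q = refl
size-split {suc n} P Q with P zero | Q zero | size-split (P ∘ suc) (Q ∘ suc)
... | true  | true  | ih = cong suc ih
... | true  | false | ih = trans (cong suc ih) (sym (+-suc _ _))
... | false | _     | ih = ih

size-pos : ∀ {n} {P : Fin n → Bool} (w : Fin n) → P w ≡ true → 1 ≤ size P
size-pos         zero    Pw rewrite Pw = s≤s z≤n
size-pos {P = P} (suc w) Pw = ≤-trans (size-pos w Pw) (m≤n+m _ (if P zero then 1 else 0))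

size≡0⇒empty : ∀ {n} {P : Fin n → Bool} {w : Fin n} → size P ≡ 0 → ¬ P w ≡ true
size≡0⇒empty {P = P} {w} P≡0 Pw = <⇒≱ (size-pos {P = P} w Pw) (≤-reflexive P≡0)

empty⇒size≡0 : ∀ {n} {P : Fin n → Bool} → (∀ w → ¬ P w ≡ true) → size P ≡ 0
empty⇒size≡0 {zero}        empty = refl
empty⇒size≡0 {suc n} {P} empty rewrite ¬-not (empty zero) = empty⇒size≡0 (empty ∘ suc)

size-≥2 : ∀ {n} {P : Fin n → Bool} {w w' : Fin n} →
          w ≢ w' → P w ≡ true → P w' ≡ true → 2 ≤ size P
size-≥2         {w = zero}  {zero}    w≢w' _  _   = contradiction refl w≢w'
size-≥2         {w = zero}  {suc w'}  _    Pw Pw' rewrite Pw  = s≤s (size-pos w' Pw')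
size-≥2         {w = suc w} {zero}    _    Pw Pw' rewrite Pw' = s≤s (size-pos w Pw)
size-≥2 {P = P} {w = suc w} {suc w'} w≢w' Pw Pw' =
  ≤-trans (size-≥2 (w≢w' ∘ cong suc) Pw Pw') (m≤n+m _ (if P zero then 1 else 0))

size≤1⇒unique : ∀ {n} {P : Fin n → Bool} {w w' : Fin n} →
                size P ≤ 1 → P w ≡ true → P w' ≡ true → w ≡ w'
size≤1⇒unique {w = w} {w'} P≤1 Pw Pw' =
  decidable-stable (w ≟ w') λ w≢w' → <⇒≱ (size-≥2 w≢w' Pw Pw') P≤1

unique⇒size≤1 : ∀ {n} {P : Fin n → Bool} →
                (∀ {w w'} → P w ≡ true → P w' ≡ true → w ≡ w') → size P ≤ 1
unique⇒size≤1 {zero}      _    = z≤n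
unique⇒size≤1 {suc n} {P} uniq with P zero in P0
... | true  = ≤-reflexive (cong suc (empty⇒size≡0 {P = P ∘ suc} λ w Pw → 0≢suc (uniq P0 Pw)))
  where
  0≢suc : ∀ {w : Fin n} → zero ≢ suc w
  0≢suc ()
... | false = unique⇒size≤1 λ Pw Pw' → Fin-suc-injective (uniq Pw Pw')

size-restrict : ∀ {n} {P Q : Fin n → Bool} →
                (∀ {w} → P w ≡ true → Q w ≡ true) → size (λ w → Q w ∧ P w) ≡ size P
size-restrict {P = P} {Q} P⊆Q = size-cong Q∧P≡P
  where
  Q∧P≡P : ∀ w → Q w ∧ P w ≡ P w
  Q∧P≡P w with P w in Pw
  ... | true  = trans (∧-identityʳ (Q w)) (P⊆Q Pw)
  ... | false = ∧-zeroʳ (Q w)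

size-remove : ∀ {n} {P : Fin n → Bool} {u : Fin n} →
              P u ≡ true → size P ≡ suc (size (λ w → P w ∧ not ⌊ w ≟ u ⌋))
size-remove {P = P} {u} Pu =
  trans (size-split P (λ w → ⌊ w ≟ u ⌋)) (cong (_+ size (λ w → P w ∧ not ⌊ w ≟ u ⌋)) at-u)
  where
  is-u : ∀ {w} → P w ∧ ⌊ w ≟ u ⌋ ≡ true → w ≡ u
  is-u {w} h = ⌊≟⌋-true⇒≡ (∧-conicalʳ (P w) _ h)
  at-u : size (λ w → P w ∧ ⌊ w ≟ u ⌋) ≡ 1
  at-u = ≤-antisym (unique⇒size≤1 λ p q → trans (is-u p) (sym (is-u q)))
                   (size-pos u (∧-true Pu (≡⇒⌊≟⌋-true refl)))

size≡2⇒unique-besides : ∀ {n} {P : Fin n → Bool} {u w w' : Fin n} → size P ≡ 2 → P u ≡ true →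
                        P w ≡ true → w ≢ u → P w' ≡ true → w' ≢ u → w ≡ w'
size≡2⇒unique-besides {P = P} {u} {w} {w'} P≡2 Pu Pw w≢u Pw' w'≢u =
  size≤1⇒unique (≤-reflexive (suc-injective (trans (sym (size-remove {P = P} Pu)) P≡2)))
                (∧-true Pw  (cong not (≢⇒⌊≟⌋-false w≢u)))
                (∧-true Pw' (cong not (≢⇒⌊≟⌋-false w'≢u)))

module _ {n : ℕ} (Γ : Graph n) where
  open Graph Γ using (adj)

  Adj? : ∀ u v → Dec (Adj Γ u v)
  Adj? u v = adj u v ≟ᵇ true

  Adj-stable : ∀ {u v} → ¬ ¬ Adj Γ u v → Adj Γ u v
  Adj-stable = decidable-stable (Adj? _ _)

  Adj-sym : ∀ {u v} → Adj Γ u v → Adj Γ v u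
  Adj-sym {u} {v} u~v = trans (Graph.sym Γ v u) u~v

  Adj-irrefl : ∀ {v} → ¬ Adj Γ v v
  Adj-irrefl {v} = not-¬ (Graph.irrefl Γ v)

  Adj⇒≢ : ∀ {u v} → Adj Γ u v → u ≢ v
  Adj⇒≢ u~v refl = Adj-irrefl u~v

  common-sym : ∀ u v → common Γ u v ≡ common Γ v u
  common-sym u v = begin
    common Γ u v                   ≡⟨ count≡size Γ _ ⟩
    size (λ w → adj u w ∧ adj v w) ≡⟨ size-cong (λ w → ∧-comm (adj u w) (adj v w)) ⟩
    size (λ w → adj v w ∧ adj u w) ≡⟨ count≡size Γ _ ⟨
    common Γ v u                   ∎
    where open ≡-Reasoning

  N[_]∖N[_] : Fin n → Fin n → Fin n → Bool
  N[ u ]∖N[ v ] w = adj u w ∧ not (adj v w)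

  ∖-intro : ∀ {u v w} → Adj Γ u w → ¬ Adj Γ v w → N[ u ]∖N[ v ] w ≡ true
  ∖-intro u~w ¬v~w = ∧-true u~w (¬⇒not≡true ¬v~w)

  ∖-elim : ∀ {u v w} → N[ u ]∖N[ v ] w ≡ true → Adj Γ u w × ¬ Adj Γ v w
  ∖-elim {u} h = ∧-conicalˡ _ _ h , not≡true⇒¬ (∧-conicalʳ (adj u _) _ h)

  module Bset (b : ℕ) where
    open WithB Γ b

    InB⇒≢ : ∀ {v u} → InB v u → u ≢ v
    InB⇒≢ h u≡v = not≡true⇒¬ (∧-conicalˡ _ _ h) (≡⇒⌊≟⌋-true u≡v)

    InB⇒common : ∀ {v u} → InB v u → common Γ u v ≡ b
    InB⇒common h = ≡ᵇ⇒≡ _ _ (Equivalence.from T-≡ (∧-conicalʳ _ _ h))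

    common⇒InB : ∀ {v u} → u ≢ v → common Γ u v ≡ b → InB v u
    common⇒InB u≢v c≡b =
      ∧-true (cong not (≢⇒⌊≟⌋-false u≢v)) (Equivalence.to T-≡ (≡⇒≡ᵇ _ _ c≡b))

    InB-sym : ∀ {v u} → InB v u → InB u v
    InB-sym h = common⇒InB (InB⇒≢ h ∘ sym) (trans (common-sym _ _) (InB⇒common h))

    β≤1 : ∀ {x} → (∀ {xi xj} → InB x xi → InB x xj → xi ≡ xj) → βof x ≤ 1
    β≤1 {x} uniq = subst (_≤ 1) (sym (count≡size Γ (inB x))) (unique⇒size≤1 uniq)

  module KIsSucB (b : ℕ) (deg≡ : ∀ v → deg Γ v ≡ suc b) where
    open WithB Γ b
    open Bset b

    deg-split : ∀ u v → suc b ≡ common Γ u v + size N[ u ]∖N[ v ]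
    deg-split u v = begin
      suc b                                               ≡⟨ deg≡ u ⟨
      deg Γ u                                             ≡⟨ count≡size Γ (adj u) ⟩
      size (adj u)                                        ≡⟨ size-split (adj u) (adj v) ⟩
      size (λ w → adj u w ∧ adj v w) + size N[ u ]∖N[ v ] ≡⟨ cong (_+ size N[ u ]∖N[ v ]) (count≡size Γ _) ⟨
      common Γ u v + size N[ u ]∖N[ v ]                   ∎
      where open ≡-Reasoning

    private-size : ∀ {v u} → InB v u → size N[ v ]∖N[ u ] ≡ 1
    private-size {v} {u} u∈Bv = +-cancelˡ-≡ b _ _ (begin
      b + size N[ v ]∖N[ u ]            ≡⟨ cong (_+ size N[ v ]∖N[ u ]) (InB⇒common (InB-sym u∈Bv)) ⟨
      common Γ v u + size N[ v ]∖N[ u ] ≡⟨ deg-split v u ⟨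
      suc b                             ≡⟨ +-comm 1 b ⟩
      b + 1                             ∎)
      where open ≡-Reasoning

    private-unique : ∀ {v u w w'} → InB v u →
                     Adj Γ v w → ¬ Adj Γ u w → Adj Γ v w' → ¬ Adj Γ u w' → w ≡ w'
    private-unique u∈Bv v~w ¬u~w v~w' ¬u~w' =
      size≤1⇒unique (≤-reflexive (private-size u∈Bv)) (∖-intro v~w ¬u~w) (∖-intro v~w' ¬u~w')

    shared-nbr : ∀ {v u x w} → InB v u → Adj Γ v x → ¬ Adj Γ u x → Adj Γ v w → w ≢ x → Adj Γ u w
    shared-nbr u∈Bv v~x ¬u~x v~w w≢x =
      Adj-stable λ ¬u~w → w≢x (private-unique u∈Bv v~w ¬u~w v~x ¬u~x)

    module TypeA1-closure {x y : Fin n} (A1 : TypeA1 x y) (β>1 : 1 < βof x) where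

      B-adj-N∖y : ∀ {xi w} → InB x xi → Adj Γ x w → w ≢ y → Adj Γ xi w
      B-adj-N∖y xi∈B x~w w≢y =
        Adj-stable λ ¬xi~w → w≢y (proj₁ (proj₁ (proj₂ A1) _ xi∈B _) (x~w , ¬xi~w))

      B-¬adj-y : ∀ {xi} → InB x xi → ¬ Adj Γ xi y
      B-¬adj-y xi∈B = proj₂ (proj₂ (proj₁ (proj₂ A1) _ xi∈B _) refl)

      outer-unshared : ∀ {u} → ¬ Adj Γ x u → ¬ (∀ {xi} → InB x xi → Adj Γ xi u)
      outer-unshared {u} ¬x~u B~u = <⇒≱ β>1 (begin
        βof x     ≡⟨ proj₂ (proj₂ A1) ⟨
        count Γ U ≡⟨ count≡size Γ U ⟩
        size U    ≤⟨ unique⇒size≤1 (λ p q → trans (U⊆u p) (sym (U⊆u q))) ⟩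
        1         ∎)
        where
        open ≤-Reasoning
        U : Fin n → Bool
        U w = not (adj x w) ∧ foldr (λ xi r → (inB x xi ∧ adj xi w) ∨ r) false (allFin n)
        U⊆u : ∀ {w} → U w ≡ true → w ≡ u
        U⊆u {w} Uw with foldr-∨-true _ (allFin n) (∧-conicalʳ (not (adj x w)) _ Uw)
        ... | xi , h = private-unique (InB-sym xi∈B) (∧-conicalʳ (inB x xi) _ h)
                         (not≡true⇒¬ (∧-conicalˡ _ _ Uw)) (B~u xi∈B) ¬x~u
          where xi∈B = ∧-conicalˡ _ _ h

      module _ {v u} (x~v : Adj Γ x v) (v≢y : v ≢ y) (u∈Bv : InB v u) where

        v~B : ∀ {xi} → InB x xi → Adj Γ v xi
        v~B xi∈B = Adj-sym (B-adj-N∖y xi∈B x~v v≢y)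

        B-adj : Adj Γ x u
        B-adj = Adj-stable λ ¬x~u → outer-unshared ¬x~u λ xi∈B →
          Adj-sym (shared-nbr u∈Bv (Adj-sym x~v) (¬x~u ∘ Adj-sym) (v~B xi∈B) (InB⇒≢ xi∈B))

        B-avoids-y : u ≢ y
        B-avoids-y u≡y = <⇒≱ β>1 (β≤1 λ xi∈B xj∈B →
          private-unique u∈Bv (v~B xi∈B) (¬u~B xi∈B) (v~B xj∈B) (¬u~B xj∈B))
          where
          ¬u~B : ∀ {xi} → InB x xi → ¬ Adj Γ u xi
          ¬u~B xi∈B = subst (λ t → ¬ Adj Γ t _) (sym u≡y) (B-¬adj-y xi∈B ∘ Adj-sym)

    module Deza (a : ℕ) (dichotomy : ∀ u v → u ≢ v → (common Γ u v ≡ b) ⊎ (common Γ u v ≡ a)) where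

      common-drop : ∀ {v u z} → InB v u → InB z u → ¬ InB z v → v ≢ z →
                    (∀ {w} → Adj Γ u w → ¬ Adj Γ z w → Adj Γ v w) →
                    (∀ {w} → Adj Γ z w → Adj Γ v w → Adj Γ u w) × b ≡ suc a
      -- N(z) ∩ N(u) and N(z) ∩ N(v) share the A vertices of N(z) ∩ N(u) ∩ N(v); the first
      -- has exactly one more (the private neighbour of u w.r.t. v lies in N(z)), the second
      -- at most one more, and it cannot have one since v ∉ B(z).
      common-drop {v} {u} {z} u∈Bv u∈Bz v∉Bz v≢z u∖z⊆v = zv⊆u , b≡1+a
        where
        open ≡-Reasoning
        zv∖u : Fin n → Bool
        zv∖u w = (adj z w ∧ adj v w) ∧ not (adj u w)

        A R : ℕ
        A = size (λ w → (adj z w ∧ adj u w) ∧ adj v w)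
        R = size zv∖u

        u∖v⊆z : ∀ {w} → N[ u ]∖N[ v ] w ≡ true → adj z w ≡ true
        u∖v⊆z h = Adj-stable λ ¬z~w → proj₂ (∖-elim h) (u∖z⊆v (proj₁ (∖-elim h)) ¬z~w)

        zu∖v≡1 : size (λ w → (adj z w ∧ adj u w) ∧ not (adj v w)) ≡ 1
        zu∖v≡1 = begin
          size (λ w → (adj z w ∧ adj u w) ∧ not (adj v w)) ≡⟨ size-cong (λ w → ∧-assoc (adj z w) _ _) ⟩
          size (λ w → adj z w ∧ N[ u ]∖N[ v ] w)           ≡⟨ size-restrict {P = N[ u ]∖N[ v ]} u∖v⊆z ⟩
          size N[ u ]∖N[ v ]                               ≡⟨ private-size (InB-sym u∈Bv) ⟩
          1                                                ∎

        b≡A+1 : b ≡ A + 1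
        b≡A+1 = begin
          b                              ≡⟨ InB⇒common (InB-sym u∈Bz) ⟨
          common Γ z u                   ≡⟨ count≡size Γ _ ⟩
          size (λ w → adj z w ∧ adj u w) ≡⟨ size-split _ (adj v) ⟩
          A + _                          ≡⟨ cong (A +_) zu∖v≡1 ⟩
          A + 1                          ∎

        vz≡A+R : common Γ v z ≡ A + R
        vz≡A+R = begin
          common Γ v z                                   ≡⟨ common-sym v z ⟩
          common Γ z v                                   ≡⟨ count≡size Γ _ ⟩
          size (λ w → adj z w ∧ adj v w)                 ≡⟨ size-split _ (adj u) ⟩
          size (λ w → (adj z w ∧ adj v w) ∧ adj u w) + R ≡⟨ cong (_+ R) (size-cong swap-vu) ⟩
          A + R                                          ∎
          where
          swap-vu : ∀ w → (adj z w ∧ adj v w) ∧ adj u w ≡ (adj z w ∧ adj u w) ∧ adj v w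
          swap-vu w = trans (∧-assoc (adj z w) _ _)
                     (trans (cong (adj z w ∧_) (∧-comm (adj v w) _)) (sym (∧-assoc (adj z w) _ _)))

        R≤1 : R ≤ 1
        R≤1 = unique⇒size≤1 {P = zv∖u} λ p q →
          size≤1⇒unique (≤-reflexive (private-size u∈Bv)) (R⊆v∖u p) (R⊆v∖u q)
          where
          R⊆v∖u : ∀ {w} → zv∖u w ≡ true → N[ v ]∖N[ u ] w ≡ true
          R⊆v∖u {w} p = ∧-true (∧-conicalʳ (adj z w) _ (∧-conicalˡ _ _ p)) (∧-conicalʳ _ _ p)

        R≡0 : R ≡ 0
        R≡0 with n≤1⇒n≡0∨n≡1 R≤1
        ... | inj₁ R≡0 = R≡0
        ... | inj₂ R≡1 = contradiction (common⇒InB v≢z vz≡b) v∉Bz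
          where
          vz≡b : common Γ v z ≡ b
          vz≡b = trans vz≡A+R (trans (cong (A +_) R≡1) (sym b≡A+1))

        a≡A : a ≡ A
        a≡A with dichotomy v z v≢z
        ... | inj₁ vz≡b = contradiction (common⇒InB v≢z vz≡b) v∉Bz
        ... | inj₂ vz≡a = begin
          a            ≡⟨ vz≡a ⟨
          common Γ v z ≡⟨ vz≡A+R ⟩
          A + R        ≡⟨ cong (A +_) R≡0 ⟩
          A + 0        ≡⟨ +-identityʳ A ⟩
          A            ∎

        b≡1+a : b ≡ suc a
        b≡1+a = trans b≡A+1 (trans (+-comm A 1) (cong suc (sym a≡A)))

        zv⊆u : ∀ {w} → Adj Γ z w → Adj Γ v w → Adj Γ u w
        zv⊆u z~w v~w = Adj-stable λ ¬u~w →
          size≡0⇒empty {P = zv∖u} R≡0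
                       (∧-true (∧-true z~w v~w) (¬⇒not≡true ¬u~w))

      module TypeA2-closure {x z : Fin n} (typeA : TypeA x) (A2 : TypeA2 x z) (β>1 : 1 < βof x) where

        B-private-is-z : ∀ {xi w} → InB x xi → Adj Γ xi w → ¬ Adj Γ x w → w ≡ z
        B-private-is-z xi∈B xi~w ¬x~w = proj₁ (proj₁ (proj₂ A2) _ xi∈B _) (xi~w , ¬x~w)

        B-adj-z : ∀ {xi} → InB x xi → Adj Γ xi z
        B-adj-z xi∈B = proj₁ (proj₂ (proj₁ (proj₂ A2) _ xi∈B _) refl)

        ¬x~z : ¬ Adj Γ x z
        ¬x~z = proj₁ (proj₂ (proj₁ A2))

        inner-unshared : ∀ {v} → Adj Γ x v → ¬ (∀ {xi} → InB x xi → ¬ Adj Γ xi v)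
        inner-unshared {v} x~v ¬B~v = <⇒≱ β>1 (begin
          βof x     ≡⟨ proj₂ (proj₂ A2) ⟨
          count Γ W ≡⟨ count≡size Γ W ⟩
          size W    ≤⟨ unique⇒size≤1 (λ p q → trans (W⊆v p) (sym (W⊆v q))) ⟩
          1         ∎)
          where
          open ≤-Reasoning
          W : Fin n → Bool
          W w = adj x w ∧ foldr (λ xi r → (inB x xi ∧ not (adj xi w)) ∨ r) false (allFin n)
          W⊆v : ∀ {w} → W w ≡ true → w ≡ v
          W⊆v {w} Ww with foldr-∨-true _ (allFin n) (∧-conicalʳ (adj x w) _ Ww)
          ... | xi , h = private-unique xi∈B (∧-conicalˡ _ _ Ww)
                           (not≡true⇒¬ (∧-conicalʳ (inB x xi) _ h)) x~v (¬B~v xi∈B)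
            where xi∈B = ∧-conicalˡ _ _ h

        module _ {v u} (x~v : Adj Γ x v) (v∉Bz : ¬ InB z v) (u∈Bv : InB v u) where

          B-adj : Adj Γ x u
          B-adj = Adj-stable λ ¬x~u → inner-unshared x~v λ xi∈B xi~v →
            v∉Bz (subst (λ t → InB t v) (u≡z ¬x~u xi∈B xi~v) (InB-sym u∈Bv))
            where
            u≡z : ∀ {xi} → ¬ Adj Γ x u → InB x xi → Adj Γ xi v → u ≡ z
            u≡z ¬x~u xi∈B xi~v = B-private-is-z xi∈B
              (Adj-sym (shared-nbr u∈Bv (Adj-sym x~v) (¬x~u ∘ Adj-sym) (Adj-sym xi~v) (InB⇒≢ xi∈B)))
              ¬x~u

          B-avoids-Bz : ¬ InB z u
          B-avoids-Bz u∈Bz = <⇒≱ β>1 (β≤1 λ xi∈B xj∈B →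
            size≡2⇒unique-besides outer≡2 (∖-intro u~x Adj-irrefl)
              (B⊆outer xi∈B) (InB⇒≢ xi∈B) (B⊆outer xj∈B) (InB⇒≢ xj∈B))
            where
            open ≡-Reasoning
            u~x : Adj Γ u x
            u~x = Adj-sym B-adj

            v≢z : v ≢ z
            v≢z v≡z = ¬x~z (subst (Adj Γ x) v≡z x~v)

            zv⊆u×b≡1+a : (∀ {w} → Adj Γ z w → Adj Γ v w → Adj Γ u w) × b ≡ suc a
            zv⊆u×b≡1+a = common-drop u∈Bv u∈Bz v∉Bz v≢z λ u~w ¬z~w →
              subst (Adj Γ v) (private-unique (InB-sym u∈Bz) u~x (¬x~z ∘ Adj-sym) u~w ¬z~w) (Adj-sym x~v)

            ux≡a : common Γ u x ≡ a
            ux≡a with dichotomy u x (Adj⇒≢ u~x)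
            ... | inj₁ ux≡b = contradiction B-adj (typeA u (common⇒InB (Adj⇒≢ u~x) ux≡b))
            ... | inj₂ ux≡a = ux≡a

            outer≡2 : size N[ u ]∖N[ x ] ≡ 2
            outer≡2 = +-cancelˡ-≡ a _ _ (begin
              a + size N[ u ]∖N[ x ]            ≡⟨ cong (_+ size N[ u ]∖N[ x ]) ux≡a ⟨
              common Γ u x + size N[ u ]∖N[ x ] ≡⟨ deg-split u x ⟨
              suc b                             ≡⟨ cong suc (proj₂ zv⊆u×b≡1+a) ⟩
              suc (suc a)                       ≡⟨ +-comm 2 a ⟩
              a + 2                             ∎)

            B⊆outer : ∀ {xi} → InB x xi → N[ u ]∖N[ x ] xi ≡ true
            B⊆outer {xi} xi∈B = ∖-intro u~xi (typeA xi xi∈B)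
              where
              u~xi : Adj Γ u xi
              u~xi with Adj? v xi
              ... | yes v~xi = proj₁ zv⊆u×b≡1+a (Adj-sym (B-adj-z xi∈B)) v~xi
              ... | no ¬v~xi = Adj-stable λ ¬u~xi → InB⇒≢ u∈Bv
                (private-unique xi∈B B-adj (¬u~xi ∘ Adj-sym) x~v (¬v~xi ∘ Adj-sym))

lemma11 : ∀ {n : ℕ} (Γ : Graph n) (k b a : ℕ) →
    IsStrictlyDeza Γ k b a → k ≡ suc b →
    (∀ v → 1 < WithB.βof Γ b v) →
    (x : Fin n) → WithB.TypeA Γ b x →
    ((y : Fin n) → WithB.TypeA1 Γ b x y →
      ∀ v → Adj Γ x v → v ≢ y →
      ∀ u → WithB.InB[] Γ b v u → Adj Γ x u × u ≢ y)
    ×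
    ((z : Fin n) → WithB.TypeA2 Γ b x z →
      ∀ v → Adj Γ x v → ¬ WithB.InB Γ b z v →
      ∀ u → WithB.InB[] Γ b v u → Adj Γ x u × ¬ WithB.InB Γ b z u)
lemma11 {n} Γ _ b a ((_ , _ , regular , dichotomy) , _) refl β>1 x typeA = part1 , part2
  where
  open WithB Γ b
  open KIsSucB Γ b regular
  open Deza a dichotomy

  part1 : (y : Fin n) → TypeA1 x y → ∀ v → Adj Γ x v → v ≢ y →
          ∀ u → InB[] v u → Adj Γ x u × u ≢ y
  part1 y A1 v x~v v≢y u  (inj₁ u∈Bv) = B-adj x~v v≢y u∈Bv , B-avoids-y x~v v≢y u∈Bv
    where open TypeA1-closure A1 (β>1 x)
  part1 y A1 v x~v v≢y .v (inj₂ refl) = x~v , v≢y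

  part2 : (z : Fin n) → TypeA2 x z → ∀ v → Adj Γ x v → ¬ InB z v →
          ∀ u → InB[] v u → Adj Γ x u × ¬ InB z u
  part2 z A2 v x~v v∉Bz u  (inj₁ u∈Bv) = B-adj x~v v∉Bz u∈Bv , B-avoids-Bz x~v v∉Bz u∈Bv
    where open TypeA2-closure typeA A2 (β>1 x)
  part2 z A2 v x~v v∉Bz .v (inj₂ refl) = x~v , v∉Bz
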